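{- Let $g$ be a positive integer and let $S, S'$ be numerical semigroups of genus $g$ such that $S'$ is a child of $S$ in the ordinarization tree $\mathcal{T}_g$. Then (1) $\mathrm{eg}(S')\subseteq \mathrm{eg}(S)$, and (2) $F(S')\in \mathrm{eg}(S)\setminus \mathrm{eg}(S')$. Consequently $h(S)>h(S')$.
   Context: A numerical semigroup is an additive submonoid $S\subseteq\mathbb{N}_0$ with finite complement; $F(S)$ is its largest gap, $m(S)$ its smallest nonzero element, $g(S)$ its number of gaps. $S_g=\{0,g+1,g+2,\ldots\}$. For $S'\neq S_g$ of genus $g$, its ordinarization transform is $S'\cup\{F(S')\}\setminus\{m(S')\}$. $S'$ is a child of $S$ in the ordinarization tree $\mathcal{T}_g$ if $S'\ne S_g$ has genus $g$ and its ordinarization transform equals $S$. Every numerical semigroup has a unique minimal generating set; the effective generators $\mathrm{eg}(S)$ are the minimal generators of $S$ that are larger than $F(S)$, and $h(S)=|\mathrm{eg}(S)|$. -}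

module Defs where

open import Data.Nat using (ℕ; zero; suc; _+_; _≤_; _<_)
open import Data.Bool using (Bool; true; false; not; _∨_)
open import Data.Nat using (_≡ᵇ_; _<ᵇ_)
open import Data.Product using (Σ; ∃; _×_; _,_)
open import Data.Sum using (_⊎_)
open import Data.List using (List; length)
open import Data.List.Membership.Propositional using (_∈_)
open import Data.List.Relation.Unary.Unique.Propositional using (Unique)
open import Relation.Binary.PropositionalEquality using (_≡_; _≢_)
open import Relation.Nullary using (¬_)
open import Function.Bundles using (_⇔_)

record NumSemigroup : Set where
  field
    mem     : ℕ → Bool
    has0    : mem 0 ≡ true
    closed  : ∀ a b → mem a ≡ true → mem b ≡ true → mem (a + b) ≡ true
    cofinite : ∃ λ N → ∀ n → N ≤ n → mem n ≡ true
open NumSemigroup public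

infix 4 _∈S_ _∉S_
_∈S_ : ℕ → NumSemigroup → Set
n ∈S S = mem S n ≡ true

_∉S_ : ℕ → NumSemigroup → Set
n ∉S S = ¬ (n ∈S S)

gapsBelow : NumSemigroup → ℕ → ℕ
gapsBelow S zero = 0
gapsBelow S (suc N) with mem S N
... | true  = gapsBelow S N
... | false = suc (gapsBelow S N)

HasGenus : NumSemigroup → ℕ → Set
HasGenus S g = ∃ λ N → (∀ n → N ≤ n → n ∈S S) × gapsBelow S N ≡ g

IsFrobenius : NumSemigroup → ℕ → Set
IsFrobenius S f = f ∉S S × (∀ n → f < n → n ∈S S)

IsMultiplicity : NumSemigroup → ℕ → Set
IsMultiplicity S m = m ∈S S × m ≢ 0 × (∀ k → 0 < k → k < m → k ∉S S)

IsMinGen : NumSemigroup → ℕ → Set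
IsMinGen S x = x ∈S S × x ≢ 0 ×
  (∀ a b → a ∈S S → b ∈S S → a ≢ 0 → b ≢ 0 → a + b ≢ x)

IsEffGen : NumSemigroup → ℕ → Set
IsEffGen S x = IsMinGen S x × (∀ f → IsFrobenius S f → f < x)

HasH : NumSemigroup → ℕ → Set
HasH S k = Σ (List ℕ) λ l → Unique l × (∀ x → (x ∈ l) ⇔ IsEffGen S x) × length l ≡ k

ordinaryMem : ℕ → ℕ → Bool
ordinaryMem g n = (n ≡ᵇ 0) ∨ (g <ᵇ n)

IsOrdinary : ℕ → NumSemigroup → Set
IsOrdinary g S = ∀ n → mem S n ≡ ordinaryMem g n

IsChild : ℕ → NumSemigroup → NumSemigroup → Set
IsChild g S S' =
  ¬ IsOrdinary g S' × HasGenus S' g ×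
  (∀ f m → IsFrobenius S' f → IsMultiplicity S' m →
     ∀ n → (n ∈S S) ⇔ ((n ∈S S' ⊎ n ≡ f) × n ≢ m))

-- Let f = F(S') and m = m(S'), so that S = S' ∪ {f} ∖ {m}; since S' is not ordinary, m < f.
-- A minimal generator x of S' satisfies x ≤ f + m, for otherwise x = m + (x − m) with
-- x − m > f in S'.  So if an effective generator x of S' were a sum in S, one summand
-- would be f and the other an element of S, which exceeds m; then x > f + m, impossible.
-- The gap f of S' becomes a minimal generator of S: both summands of a splitting of f
-- would be smaller than f, hence in S', which would put f in S'.  So eg(S') ⊆ eg(S) ∖ {f},
-- and h(S') < h(S) by counting.
module Submission where

open import Defs
open import Data.Nat using (ℕ; _≤_; _<_)
open import Data.Product using (_×_)
open import Relation.Nullary using (¬_)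

open import Data.Nat using (zero; suc; _+_; _∸_; z≤n; s≤s; z<s; _<?_; _≤?_)
open import Data.Nat.Properties
open import Data.Nat.Induction using (<-rec)
open import Data.Bool using (true; false)
import Data.Bool.Properties as Bool
open import Data.Bool.Properties using (¬-not; T-≡; ⇔→≡)
open import Data.Product using (Σ; _,_; proj₁; proj₂)
open import Data.Sum using (_⊎_; inj₁; inj₂)
open import Data.List using (List; []; _∷_; length; filter)
open import Data.List.Properties using (filter-notAll)
open import Data.List.Membership.Propositional using (_∈_; _∉_)
open import Data.List.Membership.Propositional.Properties using (∈-filter⁺)
open import Data.List.Relation.Binary.Subset.Propositional using (_⊆_)
open import Data.List.Relation.Unary.Any as Any using (here; there)
open import Data.List.Relation.Unary.All as All using ()
open import Data.List.Relation.Unary.AllPairs using (_∷_)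
open import Data.List.Relation.Unary.Unique.Propositional using (Unique)
open import Function using (_∘_)
open import Function.Bundles using (_⇔_; mk⇔; Equivalence)
open import Relation.Binary.PropositionalEquality
open import Relation.Binary.Definitions using (tri<; tri≈; tri>; DecidableEquality)
open import Relation.Nullary using (yes; no; ¬?; contradiction; _×-dec_)
open import Relation.Unary using (Pred; Decidable)

module _ {a} {A : Set a} (_≟ᴬ_ : DecidableEquality A) where

  delete : A → List A → List A
  delete z = filter (¬? ∘ (_≟ᴬ z))

  mutual
    Unique-⊆⇒length≤ : {xs ys : List A} → Unique xs → xs ⊆ ys → length xs ≤ length ys
    Unique-⊆⇒length≤ {[]} _ _ = z≤n
    Unique-⊆⇒length≤ {x ∷ xs} (x∉xs ∷ uxs) x∷xs⊆ys =
      Unique-⊆-∉⇒length< uxs (x∷xs⊆ys ∘ there) (x∷xs⊆ys (here refl))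
        (λ x∈xs → All.lookup x∉xs x∈xs refl)

    Unique-⊆-∉⇒length< : {xs ys : List A} {z : A} → Unique xs → xs ⊆ ys → z ∈ ys → z ∉ xs →
                          length xs < length ys
    Unique-⊆-∉⇒length< {xs} {ys} {z} uxs xs⊆ys z∈ys z∉xs = begin-strict
      length xs            ≤⟨ Unique-⊆⇒length≤ uxs xs⊆ys∖z ⟩
      length (delete z ys) <⟨ filter-notAll (¬? ∘ (_≟ᴬ z)) ys (Any.map (λ z≡y y≢z → y≢z (sym z≡y)) z∈ys) ⟩
      length ys            ∎
      where
      open ≤-Reasoning
      xs⊆ys∖z : xs ⊆ delete z ys
      xs⊆ys∖z y∈xs = ∈-filter⁺ (¬? ∘ (_≟ᴬ z)) (xs⊆ys y∈xs) (λ { refl → z∉xs y∈xs })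

least-witness : ∀ {ℓ} {P : Pred ℕ ℓ} → Decidable P → ∀ n → P n →
                Σ ℕ λ m → P m × (∀ k → k < m → ¬ P k)
least-witness {P = P} P? = <-rec _ search
  where
  search : ∀ n → (∀ {k} → k < n → P k → Σ ℕ λ m → P m × (∀ k → k < m → ¬ P k)) → P n →
           Σ ℕ λ m → P m × (∀ k → k < m → ¬ P k)
  search n rec Pn with anyUpTo? P? n
  ... | yes (k , k<n , Pk) = rec k<n Pk
  ... | no  none           = n , Pn , λ k k<n Pk → none (k , k<n , Pk)

frobenius-unique : ∀ {S f f'} → IsFrobenius S f → IsFrobenius S f' → f ≡ f'
frobenius-unique {f = f} {f'} (f∉S , above-f) (f'∉S , above-f') with <-cmp f f'
... | tri< f<f' _ _ = contradiction (above-f f' f<f') f'∉S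
... | tri≈ _ f≡f' _ = f≡f'
... | tri> _ _ f'<f = contradiction (above-f' f f'<f) f∉S

frobenius-exists : ∀ S N → (∀ n → N ≤ n → n ∈S S) → 0 < gapsBelow S N → Σ ℕ (IsFrobenius S)
frobenius-exists S (suc N) above with mem S N in N∈?S
... | true  = frobenius-exists S N above'
  where
  above' : ∀ n → N ≤ n → n ∈S S
  above' n N≤n with m≤n⇒m<n∨m≡n N≤n
  ... | inj₁ N<n  = above n N<n
  ... | inj₂ refl = N∈?S
... | false = λ _ → N , (λ N∈S → contradiction (trans (sym N∈?S) N∈S) λ ()) , above

multiplicity-exists : ∀ S n → suc n ∈S S → Σ ℕ (IsMultiplicity S)
multiplicity-exists S n sn∈S
  with m , (0<m , m∈S) , below ← least-witness (λ k → (0 <? k) ×-dec (mem S k Bool.≟ true))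
                                                (suc n) (z<s , sn∈S)
  = m , m∈S , n>0⇒n≢0 0<m , λ k 0<k k<m k∈S → below k k<m (0<k , k∈S)

multiplicity-≤ : ∀ {S m n} → IsMultiplicity S m → n ∈S S → n ≢ 0 → m ≤ n
multiplicity-≤ {m = m} {n} (_ , _ , below) n∈S n≢0 with m ≤? n
... | yes m≤n = m≤n
... | no  m≰n = contradiction n∈S (below n (n≢0⇒n>0 n≢0) (≰⇒> m≰n))

minGen≤frobenius+multiplicity : ∀ {S f m x} → IsFrobenius S f → IsMultiplicity S m →
                                IsMinGen S x → x ≤ f + m
minGen≤frobenius+multiplicity {f = f} {m} {x} (_ , above-f) (m∈S , m≢0 , _) (_ , _ , x-irreducible)
  with x ≤? f + m
... | yes x≤f+m = x≤f+m
... | no  x≰f+m =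
  contradiction (m+[n∸m]≡n m≤x) (x-irreducible m (x ∸ m) m∈S (above-f (x ∸ m) f<x∸m) m≢0 x∸m≢0)
  where
  f+m<x : f + m < x
  f+m<x = ≰⇒> x≰f+m
  m≤x : m ≤ x
  m≤x = ≤-trans (m≤n+m m f) (<⇒≤ f+m<x)
  f<x∸m : f < x ∸ m
  f<x∸m = subst (_< x ∸ m) (m+n∸n≡m f m) (∸-monoˡ-< f+m<x (m≤n+m m f))
  x∸m≢0 : x ∸ m ≢ 0
  x∸m≢0 = n>0⇒n≢0 (≤-<-trans z≤n f<x∸m)

frobenius<multiplicity⇒ordinary : ∀ {S f m g} → IsFrobenius S f → IsMultiplicity S m → f < m →
                                  HasGenus S g → IsOrdinary g S
frobenius<multiplicity⇒ordinary {S} {f} {g = g} (f∉S , above-f) isM f<m (N , above-N , gaps≡g)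
  = subst (λ g → IsOrdinary g S) (sym genus≡f) mem≡ordinaryMem
  where
  ∈S⇒f< : ∀ {n} → n ∈S S → n ≢ 0 → f < n
  ∈S⇒f< n∈S n≢0 = <-≤-trans f<m (multiplicity-≤ {S} isM n∈S n≢0)

  gap : ∀ k → 0 < k → k ≤ f → mem S k ≡ false
  gap k 0<k k≤f = ¬-not λ k∈S → <⇒≱ (∈S⇒f< k∈S (n>0⇒n≢0 0<k)) k≤f

  gapsBelow-upTo : ∀ j → j ≤ f → gapsBelow S (suc j) ≡ j
  gapsBelow-upTo zero    _   rewrite has0 S = refl
  gapsBelow-upTo (suc j) j<f rewrite gap (suc j) z<s j<f = cong suc (gapsBelow-upTo j (<⇒≤ j<f))

  gapsBelow-beyond : ∀ k → gapsBelow S (suc f + k) ≡ f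
  gapsBelow-beyond zero    rewrite +-identityʳ f = gapsBelow-upTo f ≤-refl
  gapsBelow-beyond (suc k) rewrite +-suc f k | above-f (suc f + k) (s≤s (m≤m+n f k)) = gapsBelow-beyond k

  genus≡f : g ≡ f
  genus≡f with f <? N
  ... | no  f≮N = contradiction (above-N f (≮⇒≥ f≮N)) f∉S
  ... | yes f<N = begin
    g                                 ≡⟨ gaps≡g ⟨
    gapsBelow S N                     ≡⟨ cong (gapsBelow S) (m+[n∸m]≡n f<N) ⟨
    gapsBelow S (suc f + (N ∸ suc f)) ≡⟨ gapsBelow-beyond (N ∸ suc f) ⟩
    f                                 ∎
    where open ≡-Reasoning

  mem≡ordinaryMem : ∀ n → mem S n ≡ ordinaryMem f n
  mem≡ordinaryMem zero    = has0 S
  mem≡ordinaryMem (suc n) = ⇔→≡ (mk⇔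
    (λ sn∈S → Equivalence.to T-≡ (<⇒<ᵇ (∈S⇒f< sn∈S λ ())))
    (λ f<ᵇsn → above-f (suc n) (<ᵇ⇒< f (suc n) (Equivalence.from T-≡ f<ᵇsn))))

multiplicity<frobenius : ∀ {S f m g} → ¬ IsOrdinary g S → HasGenus S g →
                         IsFrobenius S f → IsMultiplicity S m → m < f
multiplicity<frobenius {f = f} {m} S≢S_g hasGenus isF isM with <-cmp m f
... | tri< m<f _ _ = m<f
... | tri≈ _ refl _ = contradiction (proj₁ isM) (proj₁ isF)
... | tri> _ _ f<m = contradiction (frobenius<multiplicity⇒ordinary isF isM f<m hasGenus) S≢S_g

module Ordinarization (S S' : NumSemigroup) {f m : ℕ}
  (isF : IsFrobenius S' f) (isM : IsMultiplicity S' m) (m<f : m < f)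
  (S≈ : ∀ n → n ∈S S ⇔ ((n ∈S S' ⊎ n ≡ f) × n ≢ m)) where

  ∈S'⇒∈S : ∀ {n} → n ∈S S' → n ≢ m → n ∈S S
  ∈S'⇒∈S {n} n∈S' n≢m = Equivalence.from (S≈ n) (inj₁ n∈S' , n≢m)

  ∈S⇒∈S'⊎≡f : ∀ {n} → n ∈S S → n ∈S S' ⊎ n ≡ f
  ∈S⇒∈S'⊎≡f {n} = proj₁ ∘ Equivalence.to (S≈ n)

  f∈S : f ∈S S
  f∈S = Equivalence.from (S≈ f) (inj₂ refl , >⇒≢ m<f)

  f≢0 : f ≢ 0
  f≢0 refl = proj₁ isF (has0 S')

  ∈S⇒m< : ∀ {n} → n ∈S S → n ≢ 0 → m < n
  ∈S⇒m< {n} n∈S n≢0 with Equivalence.to (S≈ n) n∈S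
  ... | inj₂ refl , _   = m<f
  ... | inj₁ n∈S' , n≢m = ≤∧≢⇒< (multiplicity-≤ {S'} isM n∈S' n≢0) (≢-sym n≢m)

  frobenius<f : ∀ {F} → IsFrobenius S F → F < f
  frobenius<f {F} (F∉S , _) with <-cmp F f
  ... | tri< F<f _ _ = F<f
  ... | tri≈ _ refl _ = contradiction f∈S F∉S
  ... | tri> _ _ f<F = contradiction (∈S'⇒∈S (proj₂ isF F f<F) (>⇒≢ (<-trans m<f f<F))) F∉S

  effGen-preserved : ∀ x → IsEffGen S' x → IsEffGen S x
  effGen-preserved x ((x∈S' , x≢0 , x-irreducible) , above-frobenius) =
    (∈S'⇒∈S x∈S' (>⇒≢ m<x) , x≢0 , x-irreducible-in-S) , λ _ isF-S → <-trans (frobenius<f isF-S) f<x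
    where
    f<x : f < x
    f<x = above-frobenius f isF
    m<x : m < x
    m<x = <-trans m<f f<x
    f+c≢x : ∀ {c} → c ∈S S → c ≢ 0 → f + c ≢ x
    f+c≢x c∈S c≢0 f+c≡x = <⇒≱ (subst (f + m <_) f+c≡x (+-monoʳ-< f (∈S⇒m< c∈S c≢0)))
                              (minGen≤frobenius+multiplicity {S'} isF isM (x∈S' , x≢0 , x-irreducible))
    x-irreducible-in-S : ∀ a b → a ∈S S → b ∈S S → a ≢ 0 → b ≢ 0 → a + b ≢ x
    x-irreducible-in-S a b a∈S b∈S a≢0 b≢0 a+b≡x with ∈S⇒∈S'⊎≡f a∈S | ∈S⇒∈S'⊎≡f b∈S
    ... | inj₂ refl | _         = f+c≢x b∈S b≢0 a+b≡x
    ... | _         | inj₂ refl = f+c≢x a∈S a≢0 (trans (+-comm f a) a+b≡x)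
    ... | inj₁ a∈S' | inj₁ b∈S' = x-irreducible a b a∈S' b∈S' a≢0 b≢0 a+b≡x

  frobenius-effGen : IsEffGen S f
  frobenius-effGen = (f∈S , f≢0 , f-irreducible) , λ _ → frobenius<f
    where
    summand∈S' : ∀ {a b} → a ∈S S → b ≢ 0 → a + b ≡ f → a ∈S S'
    summand∈S' {a} {b} a∈S b≢0 a+b≡f with ∈S⇒∈S'⊎≡f a∈S
    ... | inj₁ a∈S' = a∈S'
    ... | inj₂ refl = contradiction (subst (a <_) a+b≡f (m<m+n a (n≢0⇒n>0 b≢0))) (<-irrefl refl)
    f-irreducible : ∀ a b → a ∈S S → b ∈S S → a ≢ 0 → b ≢ 0 → a + b ≢ f
    f-irreducible a b a∈S b∈S a≢0 b≢0 a+b≡f =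
      proj₁ isF (subst (_∈S S') a+b≡f
        (closed S' a b (summand∈S' a∈S b≢0 a+b≡f) (summand∈S' b∈S a≢0 (trans (+-comm b a) a+b≡f))))

  frobenius-not-effGen' : ¬ IsEffGen S' f
  frobenius-not-effGen' ((f∈S' , _) , _) = proj₁ isF f∈S'

mainTheorem7 : ∀ (g : ℕ) → 1 ≤ g → (S S' : NumSemigroup) →
    HasGenus S g → HasGenus S' g → IsChild g S S' →
    (∀ x → IsEffGen S' x → IsEffGen S x) ×
    (∀ f → IsFrobenius S' f → IsEffGen S f × ¬ IsEffGen S' f) ×
    (∀ h h' → HasH S h → HasH S' h' → h' < h)
mainTheorem7 g 1≤g S S' _ hasGenus'@(N , above-N , gaps≡g) (S'≢S_g , _ , S≈)
  with f , isF ← frobenius-exists S' N above-N (subst (0 <_) (sym gaps≡g) 1≤g)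
  with m , isM ← multiplicity-exists S' f (proj₂ isF (suc f) ≤-refl)
  = effGen-preserved , frobenius-part , h'<h
  where
  open Ordinarization S S' isF isM (multiplicity<frobenius S'≢S_g hasGenus' isF isM) (S≈ f m isF isM)

  frobenius-part : ∀ f' → IsFrobenius S' f' → IsEffGen S f' × ¬ IsEffGen S' f'
  frobenius-part f' isF' rewrite frobenius-unique {S'} isF' isF = frobenius-effGen , frobenius-not-effGen'

  h'<h : ∀ h h' → HasH S h → HasH S' h' → h' < h
  h'<h _ _ (l , _ , l≈eg , refl) (l' , unique-l' , l'≈eg' , refl) =
    Unique-⊆-∉⇒length< _≟_ unique-l'
      (λ {x} x∈l' → Equivalence.from (l≈eg x) (effGen-preserved x (Equivalence.to (l'≈eg' x) x∈l')))
      (Equivalence.from (l≈eg f) frobenius-effGen)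
      (frobenius-not-effGen' ∘ Equivalence.to (l'≈eg' f))
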